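{- Let $G$ be a graph and $u\in V(G)$. If $G'$ is the graph obtained from $G$ by adding a new path $v_3v_2v_1$ (on three new vertices) and the edge $uv_3$, then $\gamma_R^p(G')=\gamma_R^p(G)+2$.
   Context: All graphs are finite and simple. A perfect Roman dominating function (PRDF) on a graph $G=(V,E)$ is a function $f:V\to\{0,1,2\}$ such that every vertex $u$ with $f(u)=0$ is adjacent to exactly one vertex $v$ with $f(v)=2$. Its weight is $w(f)=\sum_{u\in V}f(u)$, and $\gamma_R^p(G)$ is the minimum weight of a PRDF on $G$. -}

module Defs where

open import Data.Nat using (ℕ; zero; suc; _+_; _≤_)
open import Data.Bool using (Bool; true; false; _∧_; _∨_; if_then_else_)
open import Data.Fin using (Fin; zero; suc; splitAt; inject+; raise; _≟_)
open import Data.Sum using (_⊎_; inj₁; inj₂)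
open import Data.List using (List; filter; length; map)
open import Data.Nat.ListAction using (sum)
open import Data.Bool using (T?)
open import Data.List using () renaming (allFin to allFinL)
open import Data.Product using (Σ; _×_; _,_; ∃)
open import Relation.Binary.PropositionalEquality using (_≡_)
open import Relation.Nullary using (¬_; does)

record Graph (n : ℕ) : Set where
  field
    adj   : Fin n → Fin n → Bool
    sym   : ∀ x y → adj x y ≡ adj y x
    irrefl : ∀ x → adj x x ≡ false
open Graph public

data Label : Set where
  l0 l1 l2 : Label

val : Label → ℕ
val l0 = 0
val l1 = 1
val l2 = 2

isTwo : Label → Bool
isTwo l2 = true
isTwo _  = false

allFin : (n : ℕ) → List (Fin n)
allFin = allFinL

weight : ∀ {n} → (Fin n → Label) → ℕ
weight {n} f = sum (map (λ v → val (f v)) (allFin n))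

twoNbrs : ∀ {n} → Graph n → (Fin n → Label) → Fin n → ℕ
twoNbrs {n} G f u = length (filter (λ v → T? (adj G u v ∧ isTwo (f v))) (allFin n))

IsPRDF : ∀ {n} → Graph n → (Fin n → Label) → Set
IsPRDF G f = ∀ u → f u ≡ l0 → twoNbrs G f u ≡ 1

IsPerfectRomanDomNumber : ∀ {n} → Graph n → ℕ → Set
IsPerfectRomanDomNumber G k =
  Σ _ (λ f → IsPRDF G f × weight f ≡ k) × (∀ f → IsPRDF G f → k ≤ weight f)

-- adjacency of the attached path: new vertices indexed by Fin 3,
-- 0 = v3, 1 = v2, 2 = v1; path v3 v2 v1.
pathAdj : Fin 3 → Fin 3 → Bool
pathAdj zero (suc zero) = true
pathAdj (suc zero) zero = true
pathAdj (suc zero) (suc (suc zero)) = true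
pathAdj (suc (suc zero)) (suc zero) = true
pathAdj _ _ = false

isV3 : Fin 3 → Bool
isV3 zero = true
isV3 _ = false

-- G' on Fin (n + 3): old vertex x is inject+ 3 x, new vertex i is raise n i
-- (v3 = raise n 0, v2 = raise n 1, v1 = raise n 2); edge u v3 added.
addAdj : ∀ {n} → Graph n → Fin n → Fin (n + 3) → Fin (n + 3) → Bool
addAdj {n} G u x y with splitAt n x | splitAt n y
... | inj₁ a | inj₁ b = adj G a b
... | inj₂ i | inj₂ j = pathAdj i j
... | inj₁ a | inj₂ j = does (a ≟ u) ∧ isV3 j
... | inj₂ i | inj₁ b = isV3 i ∧ does (b ≟ u)

private
  pathSym : ∀ i j → pathAdj i j ≡ pathAdj j i
  pathSym zero zero = _≡_.refl
  pathSym zero (suc zero) = _≡_.refl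
  pathSym zero (suc (suc zero)) = _≡_.refl
  pathSym (suc zero) zero = _≡_.refl
  pathSym (suc zero) (suc zero) = _≡_.refl
  pathSym (suc zero) (suc (suc zero)) = _≡_.refl
  pathSym (suc (suc zero)) zero = _≡_.refl
  pathSym (suc (suc zero)) (suc zero) = _≡_.refl
  pathSym (suc (suc zero)) (suc (suc zero)) = _≡_.refl

  pathIrr : ∀ i → pathAdj i i ≡ false
  pathIrr zero = _≡_.refl
  pathIrr (suc zero) = _≡_.refl
  pathIrr (suc (suc zero)) = _≡_.refl

  ∧-comm : ∀ a b → (a ∧ b) ≡ (b ∧ a)
  ∧-comm false false = _≡_.refl
  ∧-comm false true = _≡_.refl
  ∧-comm true false = _≡_.refl
  ∧-comm true true = _≡_.refl

  addSym : ∀ {n} (G : Graph n) u x y → addAdj G u x y ≡ addAdj G u y x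
  addSym {n} G u x y with splitAt n x | splitAt n y
  ... | inj₁ a | inj₁ b = sym G a b
  ... | inj₂ i | inj₂ j = pathSym i j
  ... | inj₁ a | inj₂ j = ∧-comm (does (a ≟ u)) (isV3 j)
  ... | inj₂ i | inj₁ b = ∧-comm (isV3 i) (does (b ≟ u))

  addIrr : ∀ {n} (G : Graph n) u x → addAdj G u x x ≡ false
  addIrr {n} G u x with splitAt n x
  ... | inj₁ a = irrefl G a
  ... | inj₂ i = pathIrr i

addPendantP3 : ∀ {n} → Graph n → Fin n → Graph (n + 3)
addPendantP3 G u = record { adj = addAdj G u ; sym = addSym G u ; irrefl = addIrr G u }

module Submission where

-- Upper bound: a PRDF f of G extends to G′ by labelling (v₃,v₂,v₁) with
-- (0,0,2) if f(u) = 2 and with (0,2,0) otherwise; the weight grows by 2.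
-- Lower bound: for a PRDF g of G′, the perfectness conditions at v₂ and v₁
-- force the path to carry weight ≥ 2 + [g(v₃) = 2]. Restricting g to G is
-- perfect except possibly at u, which may have lost its unique 2-neighbour
-- v₃; raising u from 0 to 1 in that case costs at most [g(v₃) = 2], so G has
-- a PRDF of weight ≤ w(g) − 2.

open import Defs hiding (sym)
open import Data.Nat using (ℕ; zero; suc; _+_; _≤_; z≤n)
open import Data.Nat.Properties
  using (+-0-commutativeMonoid; +-identityʳ; +-assoc; +-comm; +-mono-≤; +-monoˡ-≤; +-monoʳ-≤; ≤-refl; ≤-reflexive; ≤ᵇ⇒≤; module ≤-Reasoning)
open import Data.Nat.ListAction using () renaming (sum to sumList)
open import Data.Bool using (Bool; true; false; _∧_; T?)
open import Data.Bool.Properties using (∧-zeroʳ)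
open import Data.Fin using (Fin; zero; suc; _↑ˡ_; _↑ʳ_; splitAt; join; _≟_)
open import Data.Fin.Properties using (splitAt-↑ˡ; splitAt-↑ʳ; join-splitAt)
open import Data.List using (List; []; _∷_; filter; length; map; tabulate)
open import Data.List.Properties using (map-tabulate)
open import Data.Vec.Functional using (_++_)
open import Data.Vec.Functional.Properties using (lookup-++ˡ; lookup-++ʳ)
open import Data.Sum using (inj₁; inj₂)
open import Data.Product using (_×_; _,_)
open import Function using (_∘_)
open import Relation.Binary.PropositionalEquality
  using (_≡_; _≗_; refl; sym; trans; cong; cong₂; subst; module ≡-Reasoning)
open import Relation.Nullary using (does; contradiction)
open import Algebra.Properties.CommutativeMonoid.Sum +-0-commutativeMonoid
  using (sum-cong-≗; ∑-distrib-+; sum-replicate-zero) renaming (sum to ∑)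

𝟙 : Bool → ℕ
𝟙 true  = 1
𝟙 false = 0

sumList-tabulate : ∀ m (h : Fin m → ℕ) → sumList (tabulate h) ≡ ∑ h
sumList-tabulate zero    h = refl
sumList-tabulate (suc m) h = cong (h zero +_) (sumList-tabulate m (h ∘ suc))

length-filter-𝟙 : ∀ {A : Set} (p : A → Bool) (xs : List A) →
                  length (filter (T? ∘ p) xs) ≡ sumList (map (𝟙 ∘ p) xs)
length-filter-𝟙 p [] = refl
length-filter-𝟙 p (x ∷ xs) with p x
... | true  = cong suc (length-filter-𝟙 p xs)
... | false = length-filter-𝟙 p xs

∑-split : ∀ m k (h : Fin (m + k) → ℕ) → ∑ h ≡ ∑ (h ∘ (_↑ˡ k)) + ∑ (h ∘ (m ↑ʳ_))
∑-split zero    k h = refl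
∑-split (suc m) k h = trans (cong (h zero +_) (∑-split m k (h ∘ suc)))
                           (sym (+-assoc (h zero) _ _))

∑-point : ∀ {m} (u : Fin m) (q : Fin m → Bool) → ∑ (λ y → 𝟙 (does (y ≟ u) ∧ q y)) ≡ 𝟙 (q u)
∑-point {suc m} zero    q = trans (cong (𝟙 (q zero) +_) (sum-replicate-zero m)) (+-identityʳ _)
∑-point {suc m} (suc u) q = ∑-point u (q ∘ suc)

∑-mono : ∀ {m} {h h′ : Fin m → ℕ} → (∀ x → h x ≤ h′ x) → ∑ h ≤ ∑ h′
∑-mono {zero}  le = z≤n
∑-mono {suc m} le = +-mono-≤ (le zero) (∑-mono (le ∘ suc))

↑-cases : ∀ {m k} (P : Fin (m + k) → Set) →
          (∀ x → P (x ↑ˡ k)) → (∀ i → P (m ↑ʳ i)) → ∀ z → P z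
↑-cases {m} {k} P old new z = subst P (join-splitAt m k z) (go (splitAt m z))
  where
  go : ∀ s → P (join m k s)
  go (inj₁ x) = old x
  go (inj₂ i) = new i

weight-∑ : ∀ {m} (f : Fin m → Label) → weight f ≡ ∑ (val ∘ f)
weight-∑ {m} f = trans (cong sumList (map-tabulate (λ x → x) (val ∘ f)))
                       (sumList-tabulate m (val ∘ f))

weight-cong : ∀ {m} {f f′ : Fin m → Label} → f ≗ f′ → weight f ≡ weight f′
weight-cong {f = f} {f′} e = begin
  weight f      ≡⟨ weight-∑ f ⟩
  ∑ (val ∘ f)   ≡⟨ sum-cong-≗ (cong val ∘ e) ⟩
  ∑ (val ∘ f′)  ≡⟨ weight-∑ f′ ⟨
  weight f′     ∎
  where open ≡-Reasoning

weight-++ : ∀ m k (g : Fin (m + k) → Label) → weight g ≡ weight (g ∘ (_↑ˡ k)) + weight (g ∘ (m ↑ʳ_))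
weight-++ m k g = begin
  weight g                                         ≡⟨ weight-∑ g ⟩
  ∑ (val ∘ g)                                      ≡⟨ ∑-split m k (val ∘ g) ⟩
  ∑ (val ∘ g ∘ (_↑ˡ k)) + ∑ (val ∘ g ∘ (m ↑ʳ_))    ≡⟨ cong₂ _+_ (weight-∑ (g ∘ (_↑ˡ k))) (weight-∑ (g ∘ (m ↑ʳ_))) ⟨
  weight (g ∘ (_↑ˡ k)) + weight (g ∘ (m ↑ʳ_))      ∎
  where open ≡-Reasoning

twosIn : ∀ {m} → (Fin m → Bool) → (Fin m → Label) → ℕ
twosIn r f = ∑ (λ y → 𝟙 (r y ∧ isTwo (f y)))

twoNbrs-twosIn : ∀ {m} (H : Graph m) f x → twoNbrs H f x ≡ twosIn (adj H x) f
twoNbrs-twosIn {m} H f x = begin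
  twoNbrs H f x                            ≡⟨ length-filter-𝟙 p (tabulate (λ y → y)) ⟩
  sumList (map (𝟙 ∘ p) (tabulate (λ y → y))) ≡⟨ cong sumList (map-tabulate (λ y → y) (𝟙 ∘ p)) ⟩
  sumList (tabulate (𝟙 ∘ p))               ≡⟨ sumList-tabulate m (𝟙 ∘ p) ⟩
  twosIn (adj H x) f                       ∎
  where
  open ≡-Reasoning
  p : Fin m → Bool
  p y = adj H x y ∧ isTwo (f y)

twosIn-cong : ∀ {m} {r r′ : Fin m → Bool} {f f′ : Fin m → Label} →
              r ≗ r′ → (∀ y → isTwo (f y) ≡ isTwo (f′ y)) → twosIn r f ≡ twosIn r′ f′
twosIn-cong er ef = sum-cong-≗ (λ y → cong₂ (λ b c → 𝟙 (b ∧ c)) (er y) (ef y))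

twoNbrs-cong : ∀ {m} (H : Graph m) {f f′ : Fin m → Label} →
               (∀ y → isTwo (f y) ≡ isTwo (f′ y)) → ∀ x → twoNbrs H f x ≡ twoNbrs H f′ x
twoNbrs-cong H {f} {f′} ef x = begin
  twoNbrs H f x        ≡⟨ twoNbrs-twosIn H f x ⟩
  twosIn (adj H x) f   ≡⟨ twosIn-cong (λ _ → refl) ef ⟩
  twosIn (adj H x) f′  ≡⟨ twoNbrs-twosIn H f′ x ⟨
  twoNbrs H f′ x       ∎
  where open ≡-Reasoning

twosIn-++ : ∀ m k (r : Fin (m + k) → Bool) (f : Fin (m + k) → Label) →
            twosIn r f ≡ twosIn (r ∘ (_↑ˡ k)) (f ∘ (_↑ˡ k)) + twosIn (r ∘ (m ↑ʳ_)) (f ∘ (m ↑ʳ_))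
twosIn-++ m k r f = ∑-split m k (λ y → 𝟙 (r y ∧ isTwo (f y)))

-- Of the path vertices only v₃ is joined to u: an old vertex whose row into
-- the path is d ∧ isV3 sees a 2 there iff d holds and v₃ carries a 2.
twosIn-v₃-row : ∀ d (ℓ : Fin 3 → Label) → twosIn (λ j → d ∧ isV3 j) ℓ ≡ 𝟙 (d ∧ isTwo (ℓ zero))
twosIn-v₃-row true  ℓ = +-identityʳ _
twosIn-v₃-row false ℓ = refl

-- Labels of (v₃, v₂, v₁) extending a PRDF of G, given whether u carries a 2.
pathLabels : Bool → Fin 3 → Label
pathLabels _     zero             = l0
pathLabels true  (suc zero)       = l0
pathLabels true  (suc (suc zero)) = l2
pathLabels false (suc zero)       = l2
pathLabels false (suc (suc zero)) = l0

pathLabels-weight : ∀ t → weight (pathLabels t) ≡ 2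
pathLabels-weight true  = refl
pathLabels-weight false = refl

-- Each 0-labelled path vertex sees exactly one 2, where v₃ also sees u and
-- t records whether u carries a 2.
pathLabels-perfect : ∀ t j → pathLabels t j ≡ l0 →
                     𝟙 (isV3 j ∧ t) + twosIn (pathAdj j) (pathLabels t) ≡ 1
pathLabels-perfect true  zero             _ = refl
pathLabels-perfect false zero             _ = refl
pathLabels-perfect true  (suc zero)       _ = refl
pathLabels-perfect false (suc zero)       ()
pathLabels-perfect true  (suc (suc zero)) ()
pathLabels-perfect false (suc (suc zero)) _ = refl

path-weight-bound : ∀ (ℓ : Fin 3 → Label) →
  (ℓ (suc zero) ≡ l0 → twosIn (pathAdj (suc zero)) ℓ ≡ 1) →
  (ℓ (suc (suc zero)) ≡ l0 → twosIn (pathAdj (suc (suc zero))) ℓ ≡ 1) →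
  2 + 𝟙 (isTwo (ℓ zero)) ≤ weight ℓ
path-weight-bound ℓ = bound (ℓ zero) (ℓ (suc zero)) (ℓ (suc (suc zero)))
  where
  bound : ∀ a b c → (b ≡ l0 → 𝟙 (isTwo a) + (𝟙 (isTwo c) + 0) ≡ 1) → (c ≡ l0 → 𝟙 (isTwo b) + 0 ≡ 1) →
          2 + 𝟙 (isTwo a) ≤ val a + (val b + (val c + 0))
  bound a  l0 l0 _  at-v₁ = contradiction (at-v₁ refl) λ ()
  bound a  l1 l0 _  at-v₁ = contradiction (at-v₁ refl) λ ()
  bound l0 l0 l1 at-v₂ _ = contradiction (at-v₂ refl) λ ()
  bound l1 l0 l1 at-v₂ _ = contradiction (at-v₂ refl) λ ()
  bound l2 l0 l1 _ _ = ≤ᵇ⇒≤ _ _ _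
  bound l0 l0 l2 _ _ = ≤ᵇ⇒≤ _ _ _
  bound l1 l0 l2 _ _ = ≤ᵇ⇒≤ _ _ _
  bound l2 l0 l2 _ _ = ≤ᵇ⇒≤ _ _ _
  bound l0 l1 l1 _ _ = ≤ᵇ⇒≤ _ _ _
  bound l1 l1 l1 _ _ = ≤ᵇ⇒≤ _ _ _
  bound l2 l1 l1 _ _ = ≤ᵇ⇒≤ _ _ _
  bound l0 l1 l2 _ _ = ≤ᵇ⇒≤ _ _ _
  bound l1 l1 l2 _ _ = ≤ᵇ⇒≤ _ _ _
  bound l2 l1 l2 _ _ = ≤ᵇ⇒≤ _ _ _
  bound l0 l2 l0 _ _ = ≤ᵇ⇒≤ _ _ _
  bound l1 l2 l0 _ _ = ≤ᵇ⇒≤ _ _ _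
  bound l2 l2 l0 _ _ = ≤ᵇ⇒≤ _ _ _
  bound l0 l2 l1 _ _ = ≤ᵇ⇒≤ _ _ _
  bound l1 l2 l1 _ _ = ≤ᵇ⇒≤ _ _ _
  bound l2 l2 l1 _ _ = ≤ᵇ⇒≤ _ _ _
  bound l0 l2 l2 _ _ = ≤ᵇ⇒≤ _ _ _
  bound l1 l2 l2 _ _ = ≤ᵇ⇒≤ _ _ _
  bound l2 l2 l2 _ _ = ≤ᵇ⇒≤ _ _ _

bump : Bool → Label → Label
bump true  l0 = l1
bump _     l  = l

bump-l0 : ∀ t l → bump t l ≡ l0 → (l ≡ l0) × (t ≡ false)
bump-l0 true  l0 ()
bump-l0 true  l1 ()
bump-l0 true  l2 ()
bump-l0 false l  e = e , refl

bump-isTwo : ∀ t l → isTwo (bump t l) ≡ isTwo l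
bump-isTwo true  l0 = refl
bump-isTwo true  l1 = refl
bump-isTwo true  l2 = refl
bump-isTwo false l  = refl

bump-val : ∀ t l → val (bump t l) ≤ val l + 𝟙 t
bump-val true  l0 = ≤-refl
bump-val true  l1 = ≤ᵇ⇒≤ _ _ _
bump-val true  l2 = ≤ᵇ⇒≤ _ _ _
bump-val false l  = ≤-reflexive (sym (+-identityʳ (val l)))

module PendantPath {n : ℕ} (G : Graph n) (u : Fin n) where

  G′ : Graph (n + 3)
  G′ = addPendantP3 G u

  ι : Fin n → Fin (n + 3)
  ι x = x ↑ˡ 3

  ρ : Fin 3 → Fin (n + 3)
  ρ j = n ↑ʳ j

  v₃ : Fin (n + 3)
  v₃ = ρ zero

  adj-old-old : ∀ a b → adj G′ (ι a) (ι b) ≡ adj G a b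
  adj-old-old a b rewrite splitAt-↑ˡ n a 3 | splitAt-↑ˡ n b 3 = refl

  adj-old-new : ∀ a j → adj G′ (ι a) (ρ j) ≡ (does (a ≟ u) ∧ isV3 j)
  adj-old-new a j rewrite splitAt-↑ˡ n a 3 | splitAt-↑ʳ n 3 j = refl

  adj-new-old : ∀ i b → adj G′ (ρ i) (ι b) ≡ (isV3 i ∧ does (b ≟ u))
  adj-new-old i b rewrite splitAt-↑ʳ n 3 i | splitAt-↑ˡ n b 3 = refl

  adj-new-new : ∀ i j → adj G′ (ρ i) (ρ j) ≡ pathAdj i j
  adj-new-new i j rewrite splitAt-↑ʳ n 3 i | splitAt-↑ʳ n 3 j = refl

  twosIn-attachment : ∀ j (f : Fin n → Label) →
                      twosIn (λ y → isV3 j ∧ does (y ≟ u)) f ≡ 𝟙 (isV3 j ∧ isTwo (f u))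
  twosIn-attachment zero    f = ∑-point u (isTwo ∘ f)
  twosIn-attachment (suc j) f = sum-replicate-zero n

  twoNbrs-old : ∀ g x → twoNbrs G′ g (ι x) ≡ twoNbrs G (g ∘ ι) x + 𝟙 (does (x ≟ u) ∧ isTwo (g v₃))
  twoNbrs-old g x = begin
    twoNbrs G′ g (ι x)                                               ≡⟨ twoNbrs-twosIn G′ g (ι x) ⟩
    twosIn (adj G′ (ι x)) g                                          ≡⟨ twosIn-++ n 3 (adj G′ (ι x)) g ⟩
    twosIn (adj G′ (ι x) ∘ ι) (g ∘ ι) + twosIn (adj G′ (ι x) ∘ ρ) (g ∘ ρ)
      ≡⟨ cong₂ _+_ (twosIn-cong {f = g ∘ ι} (adj-old-old x) (λ _ → refl))
                   (twosIn-cong {f = g ∘ ρ} (adj-old-new x) (λ _ → refl)) ⟩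
    twosIn (adj G x) (g ∘ ι) + twosIn (λ j → does (x ≟ u) ∧ isV3 j) (g ∘ ρ)
      ≡⟨ cong₂ _+_ (sym (twoNbrs-twosIn G (g ∘ ι) x)) (twosIn-v₃-row (does (x ≟ u)) (g ∘ ρ)) ⟩
    twoNbrs G (g ∘ ι) x + 𝟙 (does (x ≟ u) ∧ isTwo (g v₃))           ∎
    where open ≡-Reasoning

  twoNbrs-new : ∀ g j → twoNbrs G′ g (ρ j) ≡ 𝟙 (isV3 j ∧ isTwo (g (ι u))) + twosIn (pathAdj j) (g ∘ ρ)
  twoNbrs-new g j = begin
    twoNbrs G′ g (ρ j)                                               ≡⟨ twoNbrs-twosIn G′ g (ρ j) ⟩
    twosIn (adj G′ (ρ j)) g                                          ≡⟨ twosIn-++ n 3 (adj G′ (ρ j)) g ⟩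
    twosIn (adj G′ (ρ j) ∘ ι) (g ∘ ι) + twosIn (adj G′ (ρ j) ∘ ρ) (g ∘ ρ)
      ≡⟨ cong₂ _+_ (twosIn-cong {f = g ∘ ι} (adj-new-old j) (λ _ → refl))
                   (twosIn-cong {f = g ∘ ρ} (adj-new-new j) (λ _ → refl)) ⟩
    twosIn (λ y → isV3 j ∧ does (y ≟ u)) (g ∘ ι) + twosIn (pathAdj j) (g ∘ ρ)
      ≡⟨ cong (_+ twosIn (pathAdj j) (g ∘ ρ)) (twosIn-attachment j (g ∘ ι)) ⟩
    𝟙 (isV3 j ∧ isTwo (g (ι u))) + twosIn (pathAdj j) (g ∘ ρ)        ∎
    where open ≡-Reasoning

  extend : (Fin n → Label) → Fin (n + 3) → Label
  extend f = f ++ pathLabels (isTwo (f u))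

  extend-weight : ∀ f → weight (extend f) ≡ weight f + 2
  extend-weight f = begin
    weight (extend f)                                   ≡⟨ weight-++ n 3 (extend f) ⟩
    weight (extend f ∘ ι) + weight (extend f ∘ ρ)       ≡⟨ cong₂ _+_ (weight-cong (lookup-++ˡ f ℓ)) (weight-cong (lookup-++ʳ f ℓ)) ⟩
    weight f + weight ℓ                                 ≡⟨ cong (weight f +_) (pathLabels-weight (isTwo (f u))) ⟩
    weight f + 2                                        ∎
    where
    open ≡-Reasoning
    ℓ = pathLabels (isTwo (f u))

  extend-perfect : ∀ f → IsPRDF G f → IsPRDF G′ (extend f)
  extend-perfect f perfect = ↑-cases (λ z → extend f z ≡ l0 → twoNbrs G′ (extend f) z ≡ 1) old new
    where
    open ≡-Reasoning
    t = isTwo (f u)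
    ℓ = pathLabels t

    old : ∀ x → extend f (ι x) ≡ l0 → twoNbrs G′ (extend f) (ι x) ≡ 1
    old x e = begin
      twoNbrs G′ (extend f) (ι x)                                         ≡⟨ twoNbrs-old (extend f) x ⟩
      twoNbrs G (extend f ∘ ι) x + 𝟙 (does (x ≟ u) ∧ isTwo (extend f v₃))
        ≡⟨ cong₂ _+_ (twoNbrs-cong G (cong isTwo ∘ lookup-++ˡ f ℓ) x)
                     (cong (λ l → 𝟙 (does (x ≟ u) ∧ isTwo l)) (lookup-++ʳ f ℓ zero)) ⟩
      twoNbrs G f x + 𝟙 (does (x ≟ u) ∧ false)                           ≡⟨ cong (λ b → twoNbrs G f x + 𝟙 b) (∧-zeroʳ _) ⟩
      twoNbrs G f x + 0                                                  ≡⟨ +-identityʳ _ ⟩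
      twoNbrs G f x                                                      ≡⟨ perfect x (trans (sym (lookup-++ˡ f ℓ x)) e) ⟩
      1                                                                  ∎

    new : ∀ j → extend f (ρ j) ≡ l0 → twoNbrs G′ (extend f) (ρ j) ≡ 1
    new j e = begin
      twoNbrs G′ (extend f) (ρ j)                                        ≡⟨ twoNbrs-new (extend f) j ⟩
      𝟙 (isV3 j ∧ isTwo (extend f (ι u))) + twosIn (pathAdj j) (extend f ∘ ρ)
        ≡⟨ cong₂ _+_ (cong (λ l → 𝟙 (isV3 j ∧ isTwo l)) (lookup-++ˡ f ℓ u))
                     (twosIn-cong {r = pathAdj j} (λ _ → refl) (cong isTwo ∘ lookup-++ʳ f ℓ)) ⟩
      𝟙 (isV3 j ∧ t) + twosIn (pathAdj j) ℓ                              ≡⟨ pathLabels-perfect t j (trans (sym (lookup-++ʳ f ℓ j)) e) ⟩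
      1                                                                  ∎

  -- Lower bound: restrict a PRDF of G′ to G, giving u a 1 if it would
  -- otherwise be a 0 that was dominated only by v₃.
  restrict : (Fin (n + 3) → Label) → Fin n → Label
  restrict g x = bump (does (x ≟ u) ∧ isTwo (g v₃)) (g (ι x))

  restrict-perfect : ∀ g → IsPRDF G′ g → IsPRDF G (restrict g)
  restrict-perfect g perfect x e with bump-l0 (does (x ≟ u) ∧ isTwo (g v₃)) (g (ι x)) e
  ... | old-zero , not-bumped = begin
    twoNbrs G (restrict g) x                              ≡⟨ twoNbrs-cong G (λ y → bump-isTwo _ (g (ι y))) x ⟩
    twoNbrs G (g ∘ ι) x                                   ≡⟨ +-identityʳ _ ⟨
    twoNbrs G (g ∘ ι) x + 𝟙 false                         ≡⟨ cong (λ b → twoNbrs G (g ∘ ι) x + 𝟙 b) not-bumped ⟨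
    twoNbrs G (g ∘ ι) x + 𝟙 (does (x ≟ u) ∧ isTwo (g v₃)) ≡⟨ twoNbrs-old g x ⟨
    twoNbrs G′ g (ι x)                                    ≡⟨ perfect (ι x) old-zero ⟩
    1                                                     ∎
    where open ≡-Reasoning

  restrict-weight : ∀ g → weight (restrict g) ≤ weight (g ∘ ι) + 𝟙 (isTwo (g v₃))
  restrict-weight g = begin
    weight (restrict g)                                     ≡⟨ weight-∑ (restrict g) ⟩
    ∑ (val ∘ restrict g)                                    ≤⟨ ∑-mono (λ x → bump-val (flag x) (g (ι x))) ⟩
    ∑ (λ x → val (g (ι x)) + 𝟙 (flag x))                    ≡⟨ ∑-distrib-+ (val ∘ g ∘ ι) (𝟙 ∘ flag) ⟩
    ∑ (val ∘ g ∘ ι) + ∑ (𝟙 ∘ flag)                          ≡⟨ cong₂ _+_ (sym (weight-∑ (g ∘ ι))) (∑-point u (λ _ → isTwo (g v₃))) ⟩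
    weight (g ∘ ι) + 𝟙 (isTwo (g v₃))                       ∎
    where
    open ≤-Reasoning
    flag : Fin n → Bool
    flag x = does (x ≟ u) ∧ isTwo (g v₃)

  lower-bound : ∀ k → (∀ f → IsPRDF G f → k ≤ weight f) → ∀ g → IsPRDF G′ g → k + 2 ≤ weight g
  lower-bound k minimal g perfect = begin
    k + 2                                   ≤⟨ +-monoˡ-≤ 2 (minimal (restrict g) (restrict-perfect g perfect)) ⟩
    weight (restrict g) + 2                 ≤⟨ +-monoˡ-≤ 2 (restrict-weight g) ⟩
    weight (g ∘ ι) + t + 2                  ≡⟨ +-assoc (weight (g ∘ ι)) t 2 ⟩
    weight (g ∘ ι) + (t + 2)                ≡⟨ cong (weight (g ∘ ι) +_) (+-comm t 2) ⟩
    weight (g ∘ ι) + (2 + t)                ≤⟨ +-monoʳ-≤ (weight (g ∘ ι)) (path-weight-bound (g ∘ ρ) (at zero) (at (suc zero))) ⟩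
    weight (g ∘ ι) + weight (g ∘ ρ)         ≡⟨ weight-++ n 3 g ⟨
    weight g                                ∎
    where
    open ≤-Reasoning
    t = 𝟙 (isTwo (g v₃))
    -- perfectness at v₂ and v₁ only involves the path, as they do not see u
    at : ∀ (j : Fin 2) → g (ρ (suc j)) ≡ l0 → twosIn (pathAdj (suc j)) (g ∘ ρ) ≡ 1
    at j e = trans (sym (twoNbrs-new g (suc j))) (perfect (ρ (suc j)) e)

lemma1 : ∀ {n} (G : Graph n) (u : Fin n) (k : ℕ) →
    IsPerfectRomanDomNumber G k →
    IsPerfectRomanDomNumber (addPendantP3 G u) (k + 2)
lemma1 G u k ((f , perfect , weight-f) , minimal) =
  (extend f , extend-perfect f perfect , trans (extend-weight f) (cong (_+ 2) weight-f)) ,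
  lower-bound k minimal
  where open PendantPath G u
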